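{- For every non-negative integer $n$ and every integer $s$, \[ 2 \sum_{k = 0}^{\lfloor n/2 \rfloor} \binom {n}{2k} 4^k F_{2k + s} = \begin{cases} F_{3n + s} + 5^{n/2}F_s, & \text{$n$ even;}\\ F_{3n + s} - 5^{(n-1)/2}L_s, & \text{$n$ odd,} \end{cases} \qquad 2 \sum_{k = 0}^{\lfloor n/2 \rfloor} \binom {n}{2k} 4^k L_{2k + s} = \begin{cases} L_{3n + s} + 5^{n/2}L_s, & \text{$n$ even;}\\ L_{3n + s} - 5^{(n+1)/2}F_s, & \text{$n$ odd.} \end{cases} \]
   Context: The Fibonacci numbers $F_j$ and Lucas numbers $L_j$ are defined for all integers $j$ by $F_0=0$, $F_1=1$, $L_0=2$, $L_1=1$, $F_j=F_{j-1}+F_{j-2}$, $L_j=L_{j-1}+L_{j-2}$, with $F_{ -j}=(-1)^{j-1}F_j$ and $L_{ -j}=(-1)^jL_j$. -}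

module Defs where

open import Data.Nat as ℕ using (ℕ; zero; suc)
open import Data.Nat.Combinatorics using (_C_)
open import Data.Integer as ℤ using (ℤ; +_; -[1+_]; _+_; _*_; -_)

Fℕ : ℕ → ℕ
Fℕ 0 = 0
Fℕ 1 = 1
Fℕ (suc (suc n)) = Fℕ (suc n) ℕ.+ Fℕ n

Lℕ : ℕ → ℕ
Lℕ 0 = 2
Lℕ 1 = 1
Lℕ (suc (suc n)) = Lℕ (suc n) ℕ.+ Lℕ n

sign : ℕ → ℤ
sign zero = + 1
sign (suc j) = - sign j

-- Extension to all integers: F_{-j} = (-1)^{j-1} F_j, L_{-j} = (-1)^j L_j
F : ℤ → ℤ
F (+ n) = + Fℕ n
F -[1+ n ] = sign n * + Fℕ (suc n)

L : ℤ → ℤ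
L (+ n) = + Lℕ n
L -[1+ n ] = sign (suc n) * + Lℕ (suc n)

sumTo : ℕ → (ℕ → ℤ) → ℤ
sumTo zero f = f 0
sumTo (suc m) f = sumTo m f + f (suc m)

binSum : (ℤ → ℤ) → ℕ → ℤ → ℤ
binSum G n s = sumTo (n ℕ./ 2) λ k → + ((n C (2 ℕ.* k)) ℕ.* (4 ℕ.^ k)) * G (+ (2 ℕ.* k) + s)

module Submission where

-- Write E for the shift (E G) t = G (t + 1). Then Σⱼ C(n,j) xʲ G (j + s) is ((I + xE)ⁿ G) s,
-- and whenever G (t + 2) = G (t + 1) + G t we have I + 2E = E³ and (I − 2E)² = 5.
-- The sum of the transforms for x = 2 and x = −2 is twice the sum over even j, which is the
-- left-hand side; finally (I − 2E) F = − L and (I − 2E) L = − 5 F.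

open import Defs
open import Data.Nat as ℕ using (ℕ; zero; suc; _≤_; _≤′_; ≤′-refl; ≤′-step; s≤s⁻¹)
open import Data.Nat.Properties as ℕP using (≤⇒≤′; ≤′⇒≤; n≤1+n)
open import Data.Nat.DivMod using (_/_; m≡m%n+[m/n]*n; m%n<n)
open import Data.Nat.Combinatorics using (_C_; nCk+nC[k+1]≡[n+1]C[k+1])
open import Data.Nat.Combinatorics.Specification using (k>n⇒nCk≡0)
open import Data.Integer using (ℤ; +_; -[1+_]; _+_; _*_; _-_; -_; _^_)
open import Data.Integer.Properties as ℤP using (pos-*; *-identityˡ; +-identityʳ)
open import Data.Integer.Tactic.RingSolver using (solve-∀)
open import Data.Product using (_×_; _,_; proj₁)
open import Relation.Binary.PropositionalEquality
open ≡-Reasoning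

sumTo-cong : ∀ n {f g : ℕ → ℤ} → (∀ j → f j ≡ g j) → sumTo n f ≡ sumTo n g
sumTo-cong zero    f≗g = f≗g 0
sumTo-cong (suc n) f≗g = cong₂ _+_ (sumTo-cong n f≗g) (f≗g (suc n))

sumTo-distrib-+ : ∀ n (f g : ℕ → ℤ) → sumTo n (λ j → f j + g j) ≡ sumTo n f + sumTo n g
sumTo-distrib-+ zero    f g = refl
sumTo-distrib-+ (suc n) f g = begin
  sumTo n (λ j → f j + g j) + (f (suc n) + g (suc n))
    ≡⟨ cong (_+ (f (suc n) + g (suc n))) (sumTo-distrib-+ n f g) ⟩
  (sumTo n f + sumTo n g) + (f (suc n) + g (suc n))
    ≡⟨ interchange (sumTo n f) (sumTo n g) (f (suc n)) (g (suc n)) ⟩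
  (sumTo n f + f (suc n)) + (sumTo n g + g (suc n)) ∎
  where
  interchange : ∀ a b c d → (a + b) + (c + d) ≡ (a + c) + (b + d)
  interchange = solve-∀

*-distribˡ-sumTo : ∀ n c (f : ℕ → ℤ) → c * sumTo n f ≡ sumTo n (λ j → c * f j)
*-distribˡ-sumTo zero    c f = refl
*-distribˡ-sumTo (suc n) c f = begin
  c * (sumTo n f + f (suc n))       ≡⟨ ℤP.*-distribˡ-+ c (sumTo n f) (f (suc n)) ⟩
  c * sumTo n f + c * f (suc n)     ≡⟨ cong (_+ c * f (suc n)) (*-distribˡ-sumTo n c f) ⟩
  sumTo n (λ j → c * f j) + c * f (suc n) ∎

sumTo-sucˡ : ∀ n (f : ℕ → ℤ) → sumTo (suc n) f ≡ f 0 + sumTo n (λ j → f (suc j))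
sumTo-sucˡ zero    f = refl
sumTo-sucˡ (suc n) f = begin
  sumTo (suc n) f + f (suc (suc n))
    ≡⟨ cong (_+ f (suc (suc n))) (sumTo-sucˡ n f) ⟩
  (f 0 + sumTo n (λ j → f (suc j))) + f (suc (suc n))
    ≡⟨ ℤP.+-assoc (f 0) _ _ ⟩
  f 0 + (sumTo n (λ j → f (suc j)) + f (suc (suc n))) ∎

sumTo-pairs : ∀ m (f : ℕ → ℤ) →
  sumTo (suc (2 ℕ.* m)) f ≡ sumTo m (λ k → f (2 ℕ.* k) + f (suc (2 ℕ.* k)))
sumTo-pairs zero    f = refl
sumTo-pairs (suc m) f = begin
  sumTo (suc (2 ℕ.* suc m)) f
    ≡⟨ cong (λ i → sumTo (suc i) f) (ℕP.*-suc 2 m) ⟩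
  (sumTo (suc (2 ℕ.* m)) f + f (2 ℕ.+ 2 ℕ.* m)) + f (3 ℕ.+ 2 ℕ.* m)
    ≡⟨ ℤP.+-assoc (sumTo (suc (2 ℕ.* m)) f) _ _ ⟩
  sumTo (suc (2 ℕ.* m)) f + (f (2 ℕ.+ 2 ℕ.* m) + f (3 ℕ.+ 2 ℕ.* m))
    ≡⟨ cong₂ _+_ (sumTo-pairs m f) (cong (λ i → f i + f (suc i)) (sym (ℕP.*-suc 2 m))) ⟩
  sumTo (suc m) (λ k → f (2 ℕ.* k) + f (suc (2 ℕ.* k))) ∎

sumTo-C-beyond : ∀ {n N} (f : ℕ → ℤ) → n ≤ N →
  sumTo N (λ j → + (n C j) * f j) ≡ sumTo n (λ j → + (n C j) * f j)
sumTo-C-beyond {n} f n≤N = go (≤⇒≤′ n≤N)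
  where
  go : ∀ {N} → n ≤′ N → sumTo N (λ j → + (n C j) * f j) ≡ sumTo n (λ j → + (n C j) * f j)
  go ≤′-refl = refl
  go (≤′-step {N} n≤′N) = begin
    sumTo N (λ j → + (n C j) * f j) + + (n C suc N) * f (suc N)
      ≡⟨ cong (λ c → sumTo N (λ j → + (n C j) * f j) + + c * f (suc N))
              (k>n⇒nCk≡0 (ℕ.s≤s (≤′⇒≤ n≤′N))) ⟩
    sumTo N (λ j → + (n C j) * f j) + + 0
      ≡⟨ +-identityʳ _ ⟩
    sumTo N (λ j → + (n C j) * f j)
      ≡⟨ go n≤′N ⟩
    sumTo n (λ j → + (n C j) * f j) ∎

sumTo-pascal : ∀ n (f : ℕ → ℤ) →
  sumTo (suc n) (λ j → + (suc n C j) * f j) ≡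
  sumTo n (λ j → + (n C j) * f j) + sumTo n (λ j → + (n C j) * f (suc j))
sumTo-pascal n f = begin
  sumTo (suc n) (λ j → + (suc n C j) * f j)
    ≡⟨ sumTo-sucˡ n _ ⟩
  + 1 * f 0 + sumTo n (λ j → + (suc n C suc j) * f (suc j))
    ≡⟨ cong (λ t → + 1 * f 0 + t) (trans (sumTo-cong n pascal) (sumTo-distrib-+ n _ _)) ⟩
  + 1 * f 0 + (shifted + sumTo n (λ j → + (n C suc j) * f (suc j)))
    ≡⟨ rearrange (+ 1 * f 0) shifted _ ⟩
  (+ 1 * f 0 + sumTo n (λ j → + (n C suc j) * f (suc j))) + shifted
    ≡⟨ cong (_+ shifted) (sym (sumTo-sucˡ n λ j → + (n C j) * f j)) ⟩
  sumTo (suc n) (λ j → + (n C j) * f j) + shifted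
    ≡⟨ cong (_+ shifted) (sumTo-C-beyond f (n≤1+n n)) ⟩
  sumTo n (λ j → + (n C j) * f j) + shifted ∎
  where
  shifted : ℤ
  shifted = sumTo n (λ j → + (n C j) * f (suc j))
  pascal : ∀ j → + (suc n C suc j) * f (suc j) ≡ + (n C j) * f (suc j) + + (n C suc j) * f (suc j)
  pascal j = trans (cong (λ c → + c * f (suc j)) (sym (nCk+nC[k+1]≡[n+1]C[k+1] n j)))
                   (ℤP.*-distribʳ-+ (f (suc j)) (+ (n C j)) (+ (n C suc j)))
  rearrange : ∀ a b c → a + (b + c) ≡ (a + c) + b
  rearrange = solve-∀

n≤1+2*[n/2] : ∀ n → n ≤ suc (2 ℕ.* (n / 2))
n≤1+2*[n/2] n = ℕP.≤-trans (ℕP.≤-reflexive (m≡m%n+[m/n]*n n 2)) (ℕP.≤-trans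
  (ℕP.+-monoˡ-≤ (n / 2 ℕ.* 2) (s≤s⁻¹ (m%n<n n 2)))
  (ℕP.≤-reflexive (cong suc (ℕP.*-comm (n / 2) 2))))

pos-^ : ∀ m n → + (m ℕ.^ n) ≡ (+ m) ^ n
pos-^ m zero    = refl
pos-^ m (suc n) = trans (pos-* m (m ℕ.^ n)) (cong (+ m *_) (pos-^ m n))

I+xE : ℤ → (ℤ → ℤ) → ℤ → ℤ
I+xE x G t = G t + x * G (t + + 1)

I+xE-translate : ∀ x a {G H : ℤ → ℤ} → (∀ t → G t ≡ H (a + t)) →
  ∀ s → I+xE x G s ≡ I+xE x H (a + s)
I+xE-translate x a {G} {H} G≗H∘a+ s = begin
  G s + x * G (s + + 1)           ≡⟨ cong₂ (λ u v → u + x * v) (G≗H∘a+ s) (G≗H∘a+ (s + + 1)) ⟩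
  H (a + s) + x * H (a + (s + + 1)) ≡⟨ cong (λ i → H (a + s) + x * H i) (sym (ℤP.+-assoc a s (+ 1))) ⟩
  H (a + s) + x * H ((a + s) + + 1) ∎

I+xE-scale : ∀ x c {G H : ℤ → ℤ} → (∀ t → G t ≡ c * H t) → ∀ s → I+xE x G s ≡ c * I+xE x H s
I+xE-scale x c {G} {H} G≗cH s = begin
  G s + x * G (s + + 1)             ≡⟨ cong₂ (λ u v → u + x * v) (G≗cH s) (G≗cH (s + + 1)) ⟩
  c * H s + x * (c * H (s + + 1))   ≡⟨ factor x c (H s) (H (s + + 1)) ⟩
  c * (H s + x * H (s + + 1))       ∎
  where
  factor : ∀ x c h h′ → c * h + x * (c * h′) ≡ c * (h + x * h′)
  factor = solve-∀

binomialTransform : ℤ → (ℤ → ℤ) → ℕ → ℤ → ℤ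
binomialTransform x G n s = sumTo n (λ j → + (n C j) * (x ^ j * G (+ j + s)))

binomialTransform-suc : ∀ x G n s →
  binomialTransform x G (suc n) s ≡ I+xE x (binomialTransform x G n) s
binomialTransform-suc x G n s = begin
  B (suc n) s
    ≡⟨ sumTo-pascal n (λ j → x ^ j * G (+ j + s)) ⟩
  B n s + sumTo n (λ j → + (n C j) * (x ^ suc j * G (+ suc j + s)))
    ≡⟨ cong (_+_ (B n s)) (trans (sumTo-cong n pull-x) (sym (*-distribˡ-sumTo n x _))) ⟩
  B n s + x * B n (s + + 1) ∎
  where
  B : ℕ → ℤ → ℤ
  B = binomialTransform x G
  pull-x : ∀ j → + (n C j) * (x ^ suc j * G (+ suc j + s)) ≡ x * (+ (n C j) * (x ^ j * G (+ j + (s + + 1))))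
  pull-x j = begin
    + (n C j) * (x * x ^ j * G (+ suc j + s))
      ≡⟨ cong (λ i → + (n C j) * (x * x ^ j * G i)) (shift-index (+ j) s) ⟩
    + (n C j) * (x * x ^ j * G (+ j + (s + + 1)))
      ≡⟨ reassoc (+ (n C j)) x (x ^ j) _ ⟩
    x * (+ (n C j) * (x ^ j * G (+ j + (s + + 1)))) ∎
    where
    shift-index : ∀ a s → (+ 1 + a) + s ≡ a + (s + + 1)
    shift-index = solve-∀
    reassoc : ∀ c x p g → c * (x * p * g) ≡ x * (c * (p * g))
    reassoc = solve-∀

^-even≡4^ : ∀ {x} → x ^ 2 ≡ + 4 → ∀ k → x ^ (2 ℕ.* k) ≡ + (4 ℕ.^ k)
^-even≡4^ {x} x²≡4 k = begin
  x ^ (2 ℕ.* k)  ≡⟨ sym (ℤP.^-*-assoc x 2 k) ⟩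
  (x ^ 2) ^ k    ≡⟨ cong (_^ k) x²≡4 ⟩
  (+ 4) ^ k      ≡⟨ sym (pos-^ 4 k) ⟩
  + (4 ℕ.^ k)    ∎

sumTo-even-terms : ∀ (G : ℤ → ℤ) n m s →
  sumTo (suc (2 ℕ.* m)) (λ j → + (n C j) * (((+ 2) ^ j + (- + 2) ^ j) * G (+ j + s))) ≡
  + 2 * sumTo m (λ k → + ((n C (2 ℕ.* k)) ℕ.* (4 ℕ.^ k)) * G (+ (2 ℕ.* k) + s))
sumTo-even-terms G n m s = begin
  sumTo (suc (2 ℕ.* m)) term                          ≡⟨ sumTo-pairs m term ⟩
  sumTo m (λ k → term (2 ℕ.* k) + term (suc (2 ℕ.* k))) ≡⟨ sumTo-cong m pair ⟩
  sumTo m (λ k → + 2 * even k)                        ≡⟨ sym (*-distribˡ-sumTo m (+ 2) even) ⟩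
  + 2 * sumTo m even                                  ∎
  where
  term : ℕ → ℤ
  term j = + (n C j) * (((+ 2) ^ j + (- + 2) ^ j) * G (+ j + s))
  even : ℕ → ℤ
  even k = + ((n C (2 ℕ.* k)) ℕ.* (4 ℕ.^ k)) * G (+ (2 ℕ.* k) + s)
  odd-cancels : ∀ c₀ c₁ p g g′ →
    c₀ * ((p + p) * g) + c₁ * ((+ 2 * p + - + 2 * p) * g′) ≡ + 2 * (c₀ * p * g)
  odd-cancels = solve-∀
  pair : ∀ k → term (2 ℕ.* k) + term (suc (2 ℕ.* k)) ≡ + 2 * even k
  pair k = begin
    c₀ * ((2^[2k] + [-2]^[2k]) * g) + c₁ * ((+ 2 * 2^[2k] + - + 2 * [-2]^[2k]) * g′)
      ≡⟨ cong₂ (λ p q → c₀ * ((p + q) * g) + c₁ * ((+ 2 * p + - + 2 * q) * g′))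
               (^-even≡4^ refl k) (^-even≡4^ refl k) ⟩
    c₀ * ((+ (4 ℕ.^ k) + + (4 ℕ.^ k)) * g) + c₁ * ((+ 2 * + (4 ℕ.^ k) + - + 2 * + (4 ℕ.^ k)) * g′)
      ≡⟨ odd-cancels c₀ c₁ (+ (4 ℕ.^ k)) g g′ ⟩
    + 2 * (c₀ * + (4 ℕ.^ k) * g)
      ≡⟨ cong (λ c → + 2 * (c * g)) (sym (pos-* (n C (2 ℕ.* k)) (4 ℕ.^ k))) ⟩
    + 2 * even k ∎
    where
    c₀ c₁ g g′ 2^[2k] [-2]^[2k] : ℤ
    c₀ = + (n C (2 ℕ.* k))
    c₁ = + (n C suc (2 ℕ.* k))
    g  = G (+ (2 ℕ.* k) + s)
    g′ = G (+ suc (2 ℕ.* k) + s)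
    2^[2k] = (+ 2) ^ (2 ℕ.* k)
    [-2]^[2k] = (- + 2) ^ (2 ℕ.* k)

twice-binSum : ∀ G n s →
  + 2 * binSum G n s ≡ binomialTransform (+ 2) G n s + binomialTransform (- + 2) G n s
twice-binSum G n s = begin
  + 2 * binSum G n s
    ≡⟨ sym (sumTo-even-terms G n (n / 2) s) ⟩
  sumTo (suc (2 ℕ.* (n / 2))) (λ j → + (n C j) * f j)
    ≡⟨ sumTo-C-beyond f (n≤1+2*[n/2] n) ⟩
  sumTo n (λ j → + (n C j) * f j)
    ≡⟨ trans (sumTo-cong n split) (sumTo-distrib-+ n _ _) ⟩
  binomialTransform (+ 2) G n s + binomialTransform (- + 2) G n s ∎
  where
  f : ℕ → ℤ
  f j = ((+ 2) ^ j + (- + 2) ^ j) * G (+ j + s)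
  distrib : ∀ c a b g → c * ((a + b) * g) ≡ c * (a * g) + c * (b * g)
  distrib = solve-∀
  split : ∀ j → + (n C j) * f j ≡
    + (n C j) * ((+ 2) ^ j * G (+ j + s)) + + (n C j) * ((- + 2) ^ j * G (+ j + s))
  split j = distrib (+ (n C j)) ((+ 2) ^ j) ((- + 2) ^ j) (G (+ j + s))

IsFibonacciLike : (ℤ → ℤ) → Set
IsFibonacciLike G = ∀ t → G (t + + 2) ≡ G (t + + 1) + G t

I+xE-fibonacciLike : ∀ x {G} → IsFibonacciLike G → IsFibonacciLike (I+xE x G)
I+xE-fibonacciLike x {G} rec t = begin
  G (t + + 2) + x * G ((t + + 2) + + 1)
    ≡⟨ cong (λ i → G (t + + 2) + x * G i)
            (trans (ℤP.+-assoc t (+ 2) (+ 1)) (sym (ℤP.+-assoc t (+ 1) (+ 2)))) ⟩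
  G (t + + 2) + x * G ((t + + 1) + + 2)
    ≡⟨ cong₂ (λ u v → u + x * v) (rec t) (rec (t + + 1)) ⟩
  (G (t + + 1) + G t) + x * (G ((t + + 1) + + 1) + G (t + + 1))
    ≡⟨ regroup x (G t) (G (t + + 1)) (G ((t + + 1) + + 1)) ⟩
  (G (t + + 1) + x * G ((t + + 1) + + 1)) + (G t + x * G (t + + 1)) ∎
  where
  regroup : ∀ x a b c → (b + a) + x * (c + b) ≡ (b + x * c) + (a + x * b)
  regroup = solve-∀

*-fibonacciLike : ∀ c {G} → IsFibonacciLike G → IsFibonacciLike (λ t → c * G t)
*-fibonacciLike c {G} rec t =
  trans (cong (c *_) (rec t)) (ℤP.*-distribˡ-+ c (G (t + + 1)) (G t))

fibonacciLike-unique : ∀ {G H} → IsFibonacciLike G → IsFibonacciLike H →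
  G (+ 0) ≡ H (+ 0) → G (+ 1) ≡ H (+ 1) → ∀ t → G t ≡ H t
fibonacciLike-unique {G} {H} recG recH G0≡H0 G1≡H1 t = proj₁ (agree t)
  where
  Agree : ℤ → Set
  Agree t = G t ≡ H t × G (t + + 1) ≡ H (t + + 1)

  twice : ∀ (K : ℤ → ℤ) t → K ((t + + 1) + + 1) ≡ K (t + + 2)
  twice K t = cong K (ℤP.+-assoc t (+ 1) (+ 1))

  forward : ∀ t → Agree t → Agree (t + + 1)
  forward t (e , e′) = e′ , (begin
    G ((t + + 1) + + 1) ≡⟨ trans (twice G t) (recG t) ⟩
    G (t + + 1) + G t   ≡⟨ cong₂ _+_ e′ e ⟩
    H (t + + 1) + H t   ≡⟨ sym (trans (twice H t) (recH t)) ⟩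
    H ((t + + 1) + + 1) ∎)

  predecessor : ∀ {K} → IsFibonacciLike K → ∀ t → K t ≡ K (t + + 2) - K (t + + 1)
  predecessor {K} rec t = sym (trans (cong (_- K (t + + 1)) (rec t)) (cancel (K (t + + 1)) (K t)))
    where
    cancel : ∀ a b → (a + b) - a ≡ b
    cancel = solve-∀

  backward : ∀ t → Agree (t + + 1) → Agree t
  backward t (e′ , e″) = (begin
    G t                          ≡⟨ predecessor recG t ⟩
    G (t + + 2) - G (t + + 1)    ≡⟨ cong₂ _-_ (trans (sym (twice G t)) (trans e″ (twice H t))) e′ ⟩
    H (t + + 2) - H (t + + 1)    ≡⟨ sym (predecessor recH t) ⟩
    H t                          ∎) , e′

  agree-pos : ∀ n → Agree (+ n)
  agree-pos zero    = G0≡H0 , G1≡H1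
  agree-pos (suc n) = subst Agree (cong +_ (ℕP.+-comm n 1)) (forward (+ n) (agree-pos n))

  agree-neg : ∀ n → Agree -[1+ n ]
  agree-neg zero    = backward -[1+ 0 ] (agree-pos 0)
  agree-neg (suc n) = backward -[1+ suc n ] (agree-neg n)

  agree : ∀ t → Agree t
  agree (+ n)    = agree-pos n
  agree -[1+ n ] = agree-neg n

module FibonacciLike {G : ℤ → ℤ} (rec : IsFibonacciLike G) where

  I+2E≡E³ : ∀ t → I+xE (+ 2) G t ≡ G (t + + 3)
  I+2E≡E³ t = begin
    G t + + 2 * G (t + + 1)            ≡⟨ regroup (G t) (G (t + + 1)) ⟩
    (G (t + + 1) + G t) + G (t + + 1)   ≡⟨ cong (_+ G (t + + 1)) (sym (rec t)) ⟩
    G (t + + 2) + G (t + + 1)           ≡⟨ cong (λ i → G i + G (t + + 1)) (sym (ℤP.+-assoc t (+ 1) (+ 1))) ⟩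
    G ((t + + 1) + + 1) + G (t + + 1)   ≡⟨ sym (rec (t + + 1)) ⟩
    G ((t + + 1) + + 2)                 ≡⟨ cong G (ℤP.+-assoc t (+ 1) (+ 2)) ⟩
    G (t + + 3)                         ∎
    where
    regroup : ∀ a b → a + + 2 * b ≡ (b + a) + b
    regroup = solve-∀

  [I-2E]²≡5 : ∀ t → I+xE (- + 2) (I+xE (- + 2) G) t ≡ + 5 * G t
  [I-2E]²≡5 t = begin
    I+xE (- + 2) (I+xE (- + 2) G) t
      ≡⟨ cong (λ v → G t + - + 2 * G (t + + 1) + - + 2 * (G (t + + 1) + - + 2 * v))
              (trans (cong G (ℤP.+-assoc t (+ 1) (+ 1))) (rec t)) ⟩
    G t + - + 2 * G (t + + 1) + - + 2 * (G (t + + 1) + - + 2 * (G (t + + 1) + G t))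
      ≡⟨ collapse (G t) (G (t + + 1)) ⟩
    + 5 * G t ∎
    where
    collapse : ∀ a b → a + - + 2 * b + - + 2 * (b + - + 2 * (b + a)) ≡ + 5 * a
    collapse = solve-∀

  binomialTransform[2] : ∀ n s → binomialTransform (+ 2) G n s ≡ G (+ (3 ℕ.* n) + s)
  binomialTransform[2] zero    s = trans (*-identityˡ _) (*-identityˡ _)
  binomialTransform[2] (suc n) s = begin
    binomialTransform (+ 2) G (suc n) s
      ≡⟨ binomialTransform-suc (+ 2) G n s ⟩
    I+xE (+ 2) (binomialTransform (+ 2) G n) s
      ≡⟨ I+xE-translate (+ 2) (+ (3 ℕ.* n)) {H = G} (binomialTransform[2] n) s ⟩
    I+xE (+ 2) G (+ (3 ℕ.* n) + s)
      ≡⟨ I+2E≡E³ (+ (3 ℕ.* n) + s) ⟩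
    G ((+ (3 ℕ.* n) + s) + + 3)
      ≡⟨ cong G (rotate (+ (3 ℕ.* n)) s) ⟩
    G (+ (3 ℕ.+ 3 ℕ.* n) + s)
      ≡⟨ cong (λ i → G (+ i + s)) (sym (ℕP.*-suc 3 n)) ⟩
    G (+ (3 ℕ.* suc n) + s) ∎
    where
    rotate : ∀ a s → (a + s) + + 3 ≡ (+ 3 + a) + s
    rotate = solve-∀

  binomialTransform[-2]-even : ∀ m s → binomialTransform (- + 2) G (2 ℕ.* m) s ≡ + (5 ℕ.^ m) * G s
  binomialTransform[-2]-odd  : ∀ m s →
    binomialTransform (- + 2) G (suc (2 ℕ.* m)) s ≡ + (5 ℕ.^ m) * I+xE (- + 2) G s

  binomialTransform[-2]-even zero    s =
    trans (*-identityˡ _) (trans (*-identityˡ _) (trans (cong G (ℤP.+-identityˡ s)) (sym (*-identityˡ _))))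
  binomialTransform[-2]-even (suc m) s = begin
    binomialTransform (- + 2) G (2 ℕ.* suc m) s
      ≡⟨ cong (λ n → binomialTransform (- + 2) G n s) (ℕP.*-suc 2 m) ⟩
    binomialTransform (- + 2) G (suc (suc (2 ℕ.* m))) s
      ≡⟨ binomialTransform-suc (- + 2) G (suc (2 ℕ.* m)) s ⟩
    I+xE (- + 2) (binomialTransform (- + 2) G (suc (2 ℕ.* m))) s
      ≡⟨ I+xE-scale (- + 2) (+ (5 ℕ.^ m)) (binomialTransform[-2]-odd m) s ⟩
    + (5 ℕ.^ m) * I+xE (- + 2) (I+xE (- + 2) G) s
      ≡⟨ cong (+ (5 ℕ.^ m) *_) ([I-2E]²≡5 s) ⟩
    + (5 ℕ.^ m) * (+ 5 * G s)
      ≡⟨ swap (+ (5 ℕ.^ m)) (G s) ⟩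
    + 5 * + (5 ℕ.^ m) * G s
      ≡⟨ cong (_* G s) (sym (pos-* 5 (5 ℕ.^ m))) ⟩
    + (5 ℕ.^ suc m) * G s ∎
    where
    swap : ∀ c g → c * (+ 5 * g) ≡ + 5 * c * g
    swap = solve-∀
  binomialTransform[-2]-odd m s = begin
    binomialTransform (- + 2) G (suc (2 ℕ.* m)) s
      ≡⟨ binomialTransform-suc (- + 2) G (2 ℕ.* m) s ⟩
    I+xE (- + 2) (binomialTransform (- + 2) G (2 ℕ.* m)) s
      ≡⟨ I+xE-scale (- + 2) (+ (5 ℕ.^ m)) (binomialTransform[-2]-even m) s ⟩
    + (5 ℕ.^ m) * I+xE (- + 2) G s ∎

  twice-binSum-even : ∀ m s →
    + 2 * binSum G (2 ℕ.* m) s ≡ G (+ (3 ℕ.* (2 ℕ.* m)) + s) + + (5 ℕ.^ m) * G s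
  twice-binSum-even m s = trans (twice-binSum G (2 ℕ.* m) s)
    (cong₂ _+_ (binomialTransform[2] (2 ℕ.* m) s) (binomialTransform[-2]-even m s))

  twice-binSum-odd : ∀ m s →
    + 2 * binSum G (suc (2 ℕ.* m)) s ≡ G (+ (3 ℕ.* suc (2 ℕ.* m)) + s) + + (5 ℕ.^ m) * I+xE (- + 2) G s
  twice-binSum-odd m s = trans (twice-binSum G (suc (2 ℕ.* m)) s)
    (cong₂ _+_ (binomialTransform[2] (suc (2 ℕ.* m)) s) (binomialTransform[-2]-odd m s))

-- At negative indices the recurrence is the positive one read backwards, with alternating signs.
alternating-recurrence : ∀ σ a b → σ * a ≡ (- σ) * b + (- - σ) * (b + a)
alternating-recurrence = solve-∀

F-fibonacciLike : IsFibonacciLike F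
F-fibonacciLike (+ n) =
  trans (cong (λ i → + Fℕ i) (ℕP.+-comm n 2)) (cong (λ i → + Fℕ i + + Fℕ n) (ℕP.+-comm 1 n))
F-fibonacciLike -[1+ zero ]        = refl
F-fibonacciLike -[1+ suc zero ]    = refl
F-fibonacciLike -[1+ suc (suc k) ] = alternating-recurrence (sign k) (+ Fℕ (suc k)) (+ Fℕ (suc (suc k)))

L-fibonacciLike : IsFibonacciLike L
L-fibonacciLike (+ n) =
  trans (cong (λ i → + Lℕ i) (ℕP.+-comm n 2)) (cong (λ i → + Lℕ i + + Lℕ n) (ℕP.+-comm 1 n))
L-fibonacciLike -[1+ zero ]        = refl
L-fibonacciLike -[1+ suc zero ]    = refl
L-fibonacciLike -[1+ suc (suc k) ] = alternating-recurrence (sign (suc k)) (+ Lℕ (suc k)) (+ Lℕ (suc (suc k)))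

[I-2E]F≡-L : ∀ t → I+xE (- + 2) F t ≡ - L t
[I-2E]F≡-L t = trans
  (fibonacciLike-unique (I+xE-fibonacciLike (- + 2) {F} F-fibonacciLike)
                        (*-fibonacciLike (- + 1) {L} L-fibonacciLike) refl refl t)
  (ℤP.-1*i≡-i (L t))

[I-2E]L≡-5F : ∀ t → I+xE (- + 2) L t ≡ (- + 5) * F t
[I-2E]L≡-5F = fibonacciLike-unique (I+xE-fibonacciLike (- + 2) {L} L-fibonacciLike)
                                   (*-fibonacciLike (- + 5) {F} F-fibonacciLike) refl refl

theorem11 : (s : ℤ) (m : ℕ) →
    ((+ 2 * binSum F (2 ℕ.* m) s ≡ F (+ (3 ℕ.* (2 ℕ.* m)) + s) + + (5 ℕ.^ m) * F s)
     × (+ 2 * binSum L (2 ℕ.* m) s ≡ L (+ (3 ℕ.* (2 ℕ.* m)) + s) + + (5 ℕ.^ m) * L s))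
    × ((+ 2 * binSum F (ℕ.suc (2 ℕ.* m)) s ≡ F (+ (3 ℕ.* ℕ.suc (2 ℕ.* m)) + s) - + (5 ℕ.^ m) * L s)
     × (+ 2 * binSum L (ℕ.suc (2 ℕ.* m)) s ≡ L (+ (3 ℕ.* ℕ.suc (2 ℕ.* m)) + s) - + (5 ℕ.^ ℕ.suc m) * F s))
theorem11 s m =
    (ForF.twice-binSum-even m s , ForL.twice-binSum-even m s)
  , ( trans (ForF.twice-binSum-odd m s) (cong (_+_ (F (+ (3 ℕ.* suc (2 ℕ.* m)) + s))) fibonacci-odd)
    , trans (ForL.twice-binSum-odd m s) (cong (_+_ (L (+ (3 ℕ.* suc (2 ℕ.* m)) + s))) lucas-odd) )
  where
  module ForF = FibonacciLike {F} F-fibonacciLike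
  module ForL = FibonacciLike {L} L-fibonacciLike

  fibonacci-odd : + (5 ℕ.^ m) * I+xE (- + 2) F s ≡ - (+ (5 ℕ.^ m) * L s)
  fibonacci-odd = trans (cong (+ (5 ℕ.^ m) *_) ([I-2E]F≡-L s)) (sym (ℤP.neg-distribʳ-* (+ (5 ℕ.^ m)) (L s)))

  absorb : ∀ c f → c * ((- + 5) * f) ≡ - (+ 5 * c * f)
  absorb = solve-∀

  lucas-odd : + (5 ℕ.^ m) * I+xE (- + 2) L s ≡ - (+ (5 ℕ.^ suc m) * F s)
  lucas-odd = begin
    + (5 ℕ.^ m) * I+xE (- + 2) L s  ≡⟨ cong (+ (5 ℕ.^ m) *_) ([I-2E]L≡-5F s) ⟩
    + (5 ℕ.^ m) * ((- + 5) * F s)   ≡⟨ absorb (+ (5 ℕ.^ m)) (F s) ⟩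
    - (+ 5 * + (5 ℕ.^ m) * F s)     ≡⟨ cong (λ c → - (c * F s)) (sym (pos-* 5 (5 ℕ.^ m))) ⟩
    - (+ (5 ℕ.^ suc m) * F s)       ∎
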